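{- Let $G$ be a $2$-connected graph with $|V(G)|\geq 3$. For any vertex $v$ of $G$, there is an edge $e$ of $G-v$ such that $G-V(e)$ is connected, where $V(e)$ denotes the set of ends of $e$.
   Context: Graphs are finite. $G-v$ and $G-V(e)$ denote deletion of vertices (with their incident edges). -}

module Defs where

open import Level using (0ℓ)
open import Data.Nat using (ℕ; _≥_)
open import Data.Fin using (Fin)
open import Data.Product using (_×_; ∃)
open import Relation.Binary.PropositionalEquality using (_≡_; _≢_)
open import Relation.Nullary using (¬_)

record Graph (n : ℕ) : Set₁ where
  field
    Adj       : Fin n → Fin n → Set
    Adj-sym   : ∀ {u v} → Adj u v → Adj v u
    Adj-irref : ∀ {u} → ¬ Adj u u
open Graph public

VSet : ℕ → Set₁
VSet n = Fin n → Set

data WalkIn {n : ℕ} (G : Graph n) (S : VSet n) : Fin n → Fin n → Set where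
  here : ∀ {u} → S u → WalkIn G S u u
  step : ∀ {u v w} → S u → Adj G u v → WalkIn G S v w → WalkIn G S u w

ConnectedOn : {n : ℕ} → Graph n → VSet n → Set
ConnectedOn G S = ∃ S × (∀ u w → S u → S w → WalkIn G S u w)

All : {n : ℕ} → VSet n
All _ = Data.Unit.⊤ where import Data.Unit

minus1 : {n : ℕ} → Fin n → VSet n
minus1 v x = x ≢ v

minus2 : {n : ℕ} → Fin n → Fin n → VSet n
minus2 a b x = (x ≢ a) × (x ≢ b)

Connected : {n : ℕ} → Graph n → Set
Connected G = ConnectedOn G All

TwoConnected : {n : ℕ} → Graph n → Set
TwoConnected {n} G = (n ≥ 3) × Connected G × (∀ x → ConnectedOn G (minus1 x))

module Submission where

-- Fix v and call a pair (ab, L) a configuration when ab is an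
-- edge, L is a vertex set containing v whose vertices are all reachable from
-- v inside L, and a, b ∉ L (so the edge ab lies in G - v).  If L ∪ {a, b}
-- is the whole vertex set, then G - {a, b} = G[L] is connected and we are
-- done.  Otherwise some vertex c lies outside L ∪ {a, b}, and since G has
-- no cut vertex, a c–b walk avoiding a and an a–v walk avoiding b exist.
-- Following them to the first point where they cross into L (resp. into
-- L ∪ {b}) yields a strictly larger configuration: either a vertex outside
-- L ∪ {a, b} adjacent to L, or a neighbour z ∉ L of b together with an
-- edge from a into L, in which case (bz, L ∪ {a}) is a configuration.
-- Strict supersets of Fin n are well-founded, so the enlargement stops.

open import Defs
open import Data.Nat using (ℕ; _≥_; s≤s)
open import Data.Fin using (Fin; zero; suc; punchIn)
open import Data.Fin.Properties using (_≟_; all?; ¬∀⟶∃¬; punchInᵢ≢i; punchIn-injective; 0≢1+n)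
open import Data.Fin.Subset using (Subset; _∈_; _∉_; _∪_; ⁅_⁆; _⊃_)
open import Data.Fin.Subset.Properties
  using (_∈?_; x∈⁅x⁆; x∈⁅y⁆⇒x≡y; p⊆p∪q; q⊆p∪q; x∈p∪q⁻)
open import Data.Fin.Subset.Induction using (Acc; acc; ⊃-wellFounded)
open import Data.Product using (_×_; Σ; _,_)
open import Data.Sum using (_⊎_; inj₁; inj₂)
open import Data.Empty using (⊥-elim)
open import Function using (_∘′_)
open import Relation.Nullary using (¬_; yes; no)
open import Relation.Nullary.Decidable using (_⊎-dec_)
open import Relation.Unary using (Decidable)
open import Relation.Binary.PropositionalEquality using (_≡_; _≢_; refl; sym)

adj⇒≢ : ∀ {n} (G : Graph n) {a b : Fin n} → Adj G a b → a ≢ b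
adj⇒≢ G e refl = Adj-irref G e

module Walks {n : ℕ} (G : Graph n) where

  walk-head : ∀ {S u w} → WalkIn G S u w → S u
  walk-head (here s)     = s
  walk-head (step s _ _) = s

  widen : ∀ {S T : VSet n} → (∀ {u} → S u → T u) → ∀ {u w} → WalkIn G S u w → WalkIn G T u w
  widen S⊆T (here s)        = here (S⊆T s)
  widen S⊆T (step s e rest) = step (S⊆T s) e (widen S⊆T rest)

  _++_ : ∀ {S u v w} → WalkIn G S u v → WalkIn G S v w → WalkIn G S u w
  here _        ++ walk = walk
  step s e rest ++ walk = step s e (rest ++ walk)

  _∷ʳ_ : ∀ {S u v w} → WalkIn G S u v → Adj G v w × S w → WalkIn G S u w
  here s        ∷ʳ (e , sw) = step s e (here sw)
  step s e rest ∷ʳ last     = step s e (rest ∷ʳ last)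

  reverse : ∀ {S u w} → WalkIn G S u w → WalkIn G S w u
  reverse (here s)        = here s
  reverse (step s e rest) = reverse rest ∷ʳ (Adj-sym G e , s)

  crossing : ∀ {S P : VSet n} → Decidable P → ∀ {u w} → ¬ P u → P w → WalkIn G S u w →
             Σ (Fin n) λ p → Σ (Fin n) λ q → S p × ¬ P p × P q × Adj G p q
  crossing P? ¬Pu Pw (here _) = ⊥-elim (¬Pu Pw)
  crossing P? ¬Pu Pw (step {v = q} su e rest) with P? q
  ... | yes Pq  = _ , q , su , ¬Pu , Pq , e
  ... | no ¬Pq  = crossing P? ¬Pq Pw rest

∈∉⇒≢ : ∀ {n} {L : Subset n} {x y} → x ∈ L → y ∉ L → x ≢ y
∈∉⇒≢ x∈L y∉L refl = y∉L x∈L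

insert-⊃ : ∀ {n} {L : Subset n} {q} → q ∉ L → (L ∪ ⁅ q ⁆) ⊃ L
insert-⊃ {L = L} {q} q∉L = p⊆p∪q ⁅ q ⁆ , q , q⊆p∪q L ⁅ q ⁆ (x∈⁅x⁆ q) , q∉L

∉-insert : ∀ {n} {L : Subset n} {x q} → x ∉ L → x ≢ q → x ∉ L ∪ ⁅ q ⁆
∉-insert {L = L} {x} {q} x∉L x≢q x∈ with x∈p∪q⁻ L ⁅ q ⁆ x∈
... | inj₁ x∈L = x∉L x∈L
... | inj₂ x∈q = x≢q (x∈⁅y⁆⇒x≡y q x∈q)

module Configurations {n : ℕ} (G : Graph n) (v : Fin n)
                      (no-cut-vertex : ∀ x → ConnectedOn G (minus1 x)) where
  open Walks G

  ⟨_⟩ : Subset n → VSet n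
  ⟨ L ⟩ u = u ∈ L

  walk-avoiding : ∀ x {u w} → u ≢ x → w ≢ x → WalkIn G (minus1 x) u w
  walk-avoiding x = let (_ , walks) = no-cut-vertex x in walks _ _

  record Anchored (L : Subset n) : Set where
    field
      root  : v ∈ L
      reach : ∀ {u} → u ∈ L → WalkIn G ⟨ L ⟩ v u
  open Anchored

  anchored-insert : ∀ {L q l} → Anchored L → l ∈ L → Adj G q l → Anchored (L ∪ ⁅ q ⁆)
  anchored-insert {L} {q} {l} A l∈L q~l = record { root = L⊆L∪q (root A) ; reach = reach′ }
    where
    L⊆L∪q : ∀ {u} → u ∈ L → u ∈ L ∪ ⁅ q ⁆
    L⊆L∪q = p⊆p∪q ⁅ q ⁆
    reach′ : ∀ {u} → u ∈ L ∪ ⁅ q ⁆ → WalkIn G ⟨ L ∪ ⁅ q ⁆ ⟩ v u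
    reach′ u∈ with x∈p∪q⁻ L ⁅ q ⁆ u∈
    ... | inj₁ u∈L = widen L⊆L∪q (reach A u∈L)
    ... | inj₂ u∈q rewrite x∈⁅y⁆⇒x≡y q u∈q =
      widen L⊆L∪q (reach A l∈L) ∷ʳ (Adj-sym G q~l , q⊆p∪q L ⁅ q ⁆ (x∈⁅x⁆ q))

  record Config (L : Subset n) : Set where
    constructor config
    field
      a b      : Fin n
      edge     : Adj G a b
      a∉L      : a ∉ L
      b∉L      : b ∉ L
      anchored : Anchored L

  Larger : Subset n → Set
  Larger L = Σ (Subset n) λ L′ → L′ ⊃ L × Config L′

  Outcome : Set
  Outcome = Σ (Fin n) λ a → Σ (Fin n) λ b →
              (Adj G a b × a ≢ v × b ≢ v) × ConnectedOn G (minus2 a b)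

  absorb : ∀ {L q l} (C : Config L) → let open Config C in
           q ∉ L → q ≢ a → q ≢ b → l ∈ L → Adj G q l → Larger L
  absorb {L} {q} (config a b a~b a∉L b∉L A) q∉L q≢a q≢b l∈L q~l =
    L ∪ ⁅ q ⁆ , insert-⊃ q∉L ,
    config a b a~b (∉-insert a∉L (q≢a ∘′ sym))
                   (∉-insert b∉L (q≢b ∘′ sym))
                   (anchored-insert A l∈L q~l)

  -- Walk from c to b avoiding a, and stop where the walk first enters L ∪ {b}.
  -- Entering L at an edge pq exhibits p as absorbable; entering at b gives a
  -- neighbour z ∉ L of b, and we continue with a walk from a to v avoiding b.
  enlarge : ∀ {L c} (C : Config L) → let open Config C in
            c ∉ L → c ≢ a → c ≢ b → Larger L
  enlarge {L} {c} C@(config a b a~b a∉L b∉L A) c∉L c≢a c≢b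
    with crossing (λ u → (u ∈? L) ⊎-dec (u ≟ b)) c∉L∪b (inj₂ refl)
                  (walk-avoiding a c≢a (adj⇒≢ G a~b ∘′ sym))
    where
    c∉L∪b : ¬ (c ∈ L ⊎ c ≡ b)
    c∉L∪b (inj₁ c∈L) = c∉L c∈L
    c∉L∪b (inj₂ c≡b) = c≢b c≡b
  ... | p , _ , p≢a , p∉L∪b , inj₁ q∈L , p~q =
    absorb C (λ p∈L → p∉L∪b (inj₁ p∈L)) p≢a (λ p≡b → p∉L∪b (inj₂ p≡b)) q∈L p~q
  ... | z , _ , z≢a , z∉L∪b , inj₂ refl , z~b =
    through-v (crossing (_∈? L) a∉L (root A)
                        (walk-avoiding b (adj⇒≢ G a~b) (∈∉⇒≢ (root A) b∉L)))
    where
    -- The walk from a to v avoiding b enters L along an edge pq.  If p = a,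
    -- then a is absorbable into the configuration (bz, L); otherwise p is
    -- absorbable into (ab, L).
    through-v : (Σ (Fin n) λ p → Σ (Fin n) λ q → p ≢ b × p ∉ L × q ∈ L × Adj G p q) → Larger L
    through-v (p , q , p≢b , p∉L , q∈L , p~q) with p ≟ a
    ... | yes refl = absorb (config b z (Adj-sym G z~b) b∉L (λ z∈L → z∉L∪b (inj₁ z∈L)) A)
                            a∉L (adj⇒≢ G a~b) (z≢a ∘′ sym) q∈L p~q
    ... | no p≢a   = absorb C p∉L p≢a p≢b q∈L p~q

  Covered : ∀ {L} → Config L → Fin n → Set
  Covered {L} C u = u ∈ L ⊎ u ≡ Config.a C ⊎ u ≡ Config.b C

  -- If every vertex is covered, then G - {a, b} is G[L], connected through v.
  covered⇒outcome : ∀ {L} (C : Config L) → (∀ u → Covered C u) → Outcome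
  covered⇒outcome {L} (config a b a~b a∉L b∉L A) covers =
    a , b , (a~b , v≢a ∘′ sym , v≢b ∘′ sym) , (v , v≢a , v≢b) , connected
    where
    v≢a : v ≢ a
    v≢a = ∈∉⇒≢ (root A) a∉L
    v≢b : v ≢ b
    v≢b = ∈∉⇒≢ (root A) b∉L
    L⊆G-ab : ∀ {u} → u ∈ L → minus2 a b u
    L⊆G-ab u∈L = ∈∉⇒≢ u∈L a∉L , ∈∉⇒≢ u∈L b∉L
    G-ab⊆L : ∀ u → minus2 a b u → u ∈ L
    G-ab⊆L u (u≢a , u≢b) with covers u
    ... | inj₁ u∈L        = u∈L
    ... | inj₂ (inj₁ u≡a) = ⊥-elim (u≢a u≡a)
    ... | inj₂ (inj₂ u≡b) = ⊥-elim (u≢b u≡b)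
    connected : ∀ u w → minus2 a b u → minus2 a b w → WalkIn G (minus2 a b) u w
    connected u w u∈ w∈ = widen L⊆G-ab (reverse (reach A (G-ab⊆L u u∈)) ++ reach A (G-ab⊆L w w∈))

  covers? : ∀ {L} (C : Config L) → Decidable (Covered C)
  covers? {L} C u = (u ∈? L) ⊎-dec ((u ≟ Config.a C) ⊎-dec (u ≟ Config.b C))

  search : ∀ {L} → Config L → Acc _⊃_ L → Outcome
  search {L} C (acc larger) with all? (covers? C)
  ... | yes covers = covered⇒outcome C covers
  ... | no ¬covers with ¬∀⟶∃¬ n _ (covers? C) ¬covers
  ...   | c , c-uncovered with enlarge C (c-uncovered ∘′ inj₁)
                                         (c-uncovered ∘′ inj₂ ∘′ inj₁)
                                         (c-uncovered ∘′ inj₂ ∘′ inj₂)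
  ...     | L′ , L′⊃L , C′ = search C′ (larger L′⊃L)

  singleton-anchored : Anchored ⁅ v ⁆
  singleton-anchored = record { root = x∈⁅x⁆ v ; reach = reach-v }
    where
    reach-v : ∀ {u} → u ∈ ⁅ v ⁆ → WalkIn G ⟨ ⁅ v ⁆ ⟩ v u
    reach-v u∈ rewrite x∈⁅y⁆⇒x≡y v u∈ = here (x∈⁅x⁆ v)

  -- Two distinct vertices a, b ≠ v give an initial configuration on {v}:
  -- the first edge of a walk from a to b avoiding v is an edge of G - v.
  initial : ∀ {a b} → a ≢ v → b ≢ v → a ≢ b → Config ⁅ v ⁆
  initial a≢v b≢v a≢b with walk-avoiding v a≢v b≢v
  ... | here _                  = ⊥-elim (a≢b refl)
  ... | step {v = a′} _ a~a′ rest =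
    config _ a′ a~a′ (a≢v ∘′ x∈⁅y⁆⇒x≡y v) (walk-head rest ∘′ x∈⁅y⁆⇒x≡y v) singleton-anchored

lemma2p2 : {n : ℕ} (G : Graph n) → TwoConnected G → n ≥ 3 →
    (v : Fin n) →
      Σ (Fin n) (λ a → Σ (Fin n) (λ b →
        (Adj G a b × a ≢ v × b ≢ v) × ConnectedOn G (minus2 a b)))
lemma2p2 G (_ , _ , no-cut-vertex) (s≤s (s≤s (s≤s _))) v =
  search (initial (punchInᵢ≢i v zero) (punchInᵢ≢i v (suc zero)) distinct)
         (⊃-wellFounded ⁅ v ⁆)
  where
  open Configurations G v no-cut-vertex
  distinct : punchIn v zero ≢ punchIn v (suc zero)
  distinct eq = 0≢1+n (punchIn-injective v zero (suc zero) eq)
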